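{- Let $W=a_1a_2\cdots a_n$ be a square-free word, where each $a_i$ is a single letter, and let $V=a_1^{k_1}a_2^{k_2}\cdots a_n^{k_n}$, where each $k_i$ is a positive integer. Then every square occurring as a factor of $V$ is of the form $x^{2k}$ for some positive integer $k$, where $x=a_i$ for some $i\in\{1,\dots,n\}$.
   Context: A square is a finite non-empty word of the form $XX$ with $X$ non-empty; a word is square-free if it contains no square as a factor (contiguous subword). $a^k$ denotes the letter $a$ repeated $k$ times. -}

module Defs where

open import Data.List using (List; []; _∷_; _++_; concat; zipWith; replicate)
open import Data.Nat using (ℕ)
open import Data.Product using (∃; ∃-syntax; _×_)
open import Relation.Binary.PropositionalEquality using (_≡_; _≢_)
open import Relation.Nullary using (¬_)

IsFactor : {A : Set} → List A → List A → Set
IsFactor {A} w v = ∃[ u ] ∃[ t ] (v ≡ u ++ w ++ t)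

IsSquare : {A : Set} → List A → Set
IsSquare {A} w = ∃[ X ] (X ≢ [] × w ≡ X ++ X)

SquareFree : {A : Set} → List A → Set
SquareFree w = ∀ s → IsFactor s w → ¬ IsSquare s

expand : {A : Set} → List ℕ → List A → List A
expand ks W = concat (zipWith replicate ks W)

-- Number the blocks of V = a₁^k₁ ⋯ aₙ^kₙ by 0, …, n-1; the block numbers of the
-- successive positions of V form a staircase, i.e. consecutive entries differ by 0 or 1, and
-- each position of V carries the letter of W at its block number.  An occurrence of XX in V lies over two consecutive
-- runs P, Q of block numbers that read the same letters.  Adjacent letters of W differ (aa is a
-- square), so every step of P is matched by the same step of Q: Q = P + D for a constant D.
-- If D > 0, P covers [p, p + D) and W[p, p + D) W[p + D, p + 2D) is a square in W; hence D = 0,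
-- which pins P to a single block, so XX is a power of one letter.  Working with block numbers
-- instead of letters avoids any decidable equality on the alphabet.
module Submission where

open import Defs
open import Data.Empty using (⊥; ⊥-elim)
open import Data.List using (List; []; _∷_; _++_; length; replicate; map; applyUpTo; upTo)
open import Data.List.Properties
  using (∷-injective; ∷-injectiveʳ; ++-assoc; length-++; map-++; map-∘; map-replicate; map-upTo; map-cong; map-cong-local; map-id)
open import Data.List.Membership.Propositional using (_∈_)
open import Data.List.Membership.Propositional.Properties using (∈-map⁺; ∈-upTo⁺)
open import Data.List.Relation.Unary.All as All using (All; []; _∷_)
open import Data.List.Relation.Unary.All.Properties as All using (all-upTo)
open import Data.List.Relation.Unary.Any using (here; there)
open import Data.List.Relation.Unary.Linked as Linked using (Linked; []; [-]; _∷_)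
open import Data.List.Relation.Unary.Linked.Properties using (Linked⇒All; applyUpTo⁺₂)
open import Data.Nat using (ℕ; zero; suc; _+_; _∸_; _*_; _≤_; _<_; z≤n; s≤s; s≤s⁻¹; _≟_)
open import Data.Nat.Properties
open import Data.Product using (∃-syntax; ∃₂; _×_; _,_; proj₁; proj₂)
open import Function using (_∘_; id)
open import Level using (Level; 0ℓ)
open import Relation.Binary.Core using (Rel)
open import Relation.Binary.Construct.Closure.Reflexive using (ReflClosure; refl; [_])
open import Relation.Binary.PropositionalEquality
open import Relation.Nullary using (¬_; yes; no)

private
  variable
    ℓ : Level
    A B : Set

lookupOr : A → List A → ℕ → A
lookupOr d []       _       = d
lookupOr d (x ∷ xs) zero    = x
lookupOr d (x ∷ xs) (suc i) = lookupOr d xs i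

applyUpTo-lookupOr : (d : A) (xs : List A) → xs ≡ applyUpTo (lookupOr d xs) (length xs)
applyUpTo-lookupOr d []       = refl
applyUpTo-lookupOr d (x ∷ xs) = cong (x ∷_) (applyUpTo-lookupOr d xs)

applyUpTo-+ : (f : ℕ → A) (m n : ℕ) →
              applyUpTo f (m + n) ≡ applyUpTo f m ++ applyUpTo (λ i → f (m + i)) n
applyUpTo-+ f zero    n = refl
applyUpTo-+ f (suc m) n = cong (f 0 ∷_) (applyUpTo-+ (f ∘ suc) m n)

applyUpTo-cong-< : ∀ {f g : ℕ → A} n → (∀ {i} → i < n → f i ≡ g i) → applyUpTo f n ≡ applyUpTo g n
applyUpTo-cong-< {f = f} {g} n f≡g = begin
  applyUpTo f n     ≡⟨ map-upTo f n ⟨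
  map f (upTo n)    ≡⟨ map-cong-local (All.applyUpTo⁺₁ _ n f≡g) ⟩
  map g (upTo n)    ≡⟨ map-upTo g n ⟩
  applyUpTo g n     ∎
  where open ≡-Reasoning

All-≡⇒replicate : ∀ {x : A} {xs} → All (_≡ x) xs → xs ≡ replicate (length xs) x
All-≡⇒replicate []         = refl
All-≡⇒replicate (refl ∷ h) = cong (_ ∷_) (All-≡⇒replicate h)

map-≡⇒∈-≡ : ∀ {f g : A → B} {x xs} → map f xs ≡ map g xs → x ∈ xs → f x ≡ g x
map-≡⇒∈-≡ eq (here refl) = proj₁ (∷-injective eq)
map-≡⇒∈-≡ eq (there x∈) = map-≡⇒∈-≡ (∷-injectiveʳ eq) x∈

map-++⁻ : ∀ (f : A → B) xs {ys zs} → map f xs ≡ ys ++ zs →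
          ∃₂ λ ys′ zs′ → xs ≡ ys′ ++ zs′ × map f ys′ ≡ ys × map f zs′ ≡ zs
map-++⁻ f xs       {[]}     eq = [] , xs , refl , refl , eq
map-++⁻ f []       {_ ∷ _}  ()
map-++⁻ f (x ∷ xs) {_ ∷ ys} eq with refl , eq′ ← ∷-injective eq
  with ys′ , zs′ , refl , refl , refl ← map-++⁻ f xs {ys} eq′ = x ∷ ys′ , zs′ , refl , refl , refl

IsFactor-map⁻ : ∀ (f : A → B) {s xs} → IsFactor s (map f xs) → ∃[ s′ ] IsFactor s′ xs × map f s′ ≡ s
IsFactor-map⁻ f {s} {xs} (u , t , eq)
  with u′ , st′ , refl , refl , eq′ ← map-++⁻ f xs {u} eq
  with s′ , t′ , refl , refl , refl ← map-++⁻ f st′ {s} eq′ = s′ , (u′ , t′ , refl) , refl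

All-factor : ∀ {P : A → Set ℓ} {s xs} → IsFactor s xs → All P xs → All P s
All-factor (u , t , refl) h = All.++⁻ˡ _ (All.++⁻ʳ u h)

module _ {R : Rel A ℓ} where

  Linked-++⁻ˡ : ∀ xs {ys} → Linked R (xs ++ ys) → Linked R xs
  Linked-++⁻ˡ []           _       = []
  Linked-++⁻ˡ (x ∷ [])     _       = [-]
  Linked-++⁻ˡ (x ∷ y ∷ xs) (r ∷ l) = r ∷ Linked-++⁻ˡ (y ∷ xs) l

  Linked-++⁻ʳ : ∀ xs {ys} → Linked R (xs ++ ys) → Linked R ys
  Linked-++⁻ʳ []       l = l
  Linked-++⁻ʳ (x ∷ xs) l = Linked-++⁻ʳ xs (Linked.tail l)

  Linked-factor : ∀ {s xs} → IsFactor s xs → Linked R xs → Linked R s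
  Linked-factor (u , t , refl) l = Linked-++⁻ˡ _ (Linked-++⁻ʳ u l)

expand-map : (ks : List ℕ) (f : A → B) (xs : List A) → expand ks (map f xs) ≡ map f (expand ks xs)
expand-map []       f xs       = refl
expand-map (k ∷ ks) f []       = refl
expand-map (k ∷ ks) f (x ∷ xs) = begin
  replicate k (f x) ++ expand ks (map f xs)       ≡⟨ cong₂ _++_ (sym (map-replicate f k x)) (expand-map ks f xs) ⟩
  map f (replicate k x) ++ map f (expand ks xs)   ≡⟨ map-++ f (replicate k x) (expand ks xs) ⟨
  map f (replicate k x ++ expand ks xs)           ∎
  where open ≡-Reasoning

All-expand⁺ : ∀ {P : A → Set ℓ} ks {xs} → All P xs → All P (expand ks xs)
All-expand⁺ []       _          = []
All-expand⁺ (k ∷ ks) []         = []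
All-expand⁺ (k ∷ ks) (px ∷ pxs) = All.++⁺ (All.replicate⁺ k px) (All-expand⁺ ks pxs)

module _ {R : Rel A ℓ} where

  Linked-replicate-++ : ∀ k {x ys} → Linked (ReflClosure R) (x ∷ ys) →
                        Linked (ReflClosure R) (x ∷ replicate k x ++ ys)
  Linked-replicate-++ zero    l = l
  Linked-replicate-++ (suc k) l = refl ∷ Linked-replicate-++ k l

  mutual
    Linked-expand⁺ : ∀ {ks xs} → All (1 ≤_) ks → Linked R xs → Linked (ReflClosure R) (expand ks xs)
    Linked-expand⁺ {[]}                 _             _ = []
    Linked-expand⁺ {_ ∷ _}     {[]}     _             _ = []
    Linked-expand⁺ {suc k ∷ _} {_ ∷ _}  (s≤s _ ∷ pos) l = Linked-replicate-++ k (Linked-∷-expand⁺ pos l)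

    Linked-∷-expand⁺ : ∀ {ks x xs} → All (1 ≤_) ks → Linked R (x ∷ xs) →
                       Linked (ReflClosure R) (x ∷ expand ks xs)
    Linked-∷-expand⁺ {[]}                  _                 _       = [-]
    Linked-∷-expand⁺ {_ ∷ _} {xs = []}     _                 _       = [-]
    Linked-∷-expand⁺ {_ ∷ _} {xs = _ ∷ _}  pos@(s≤s _ ∷ _)   (r ∷ l) = [ r ] ∷ Linked-expand⁺ pos l

periodic⇒¬SquareFree : (f : ℕ → A) {n b k : ℕ} → 0 < k → b + k + k ≤ n →
                       (∀ {i} → i < k → f (b + i) ≡ f (b + i + k)) → ¬ SquareFree (applyUpTo f n)
periodic⇒¬SquareFree {A = A} f {n} {b} {suc k′} _ bound periodic sf =
  sf (X ++ X) (applyUpTo f b , T , split) (X , (λ ()) , refl)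
  where
  k r : ℕ
  k = suc k′
  r = proj₁ (m≤n⇒∃[o]m+o≡n bound)
  X T : List A
  X = applyUpTo (λ i → f (b + i)) k
  T = applyUpTo (λ i → f (b + k + k + i)) r
  shifted : applyUpTo (λ i → f (b + k + i)) k ≡ X
  shifted = applyUpTo-cong-< k λ {i} i<k → begin
    f (b + k + i)   ≡⟨ cong f (trans (+-assoc b k i) (cong (b +_) (+-comm k i))) ⟩
    f (b + (i + k)) ≡⟨ cong f (+-assoc b i k) ⟨
    f (b + i + k)   ≡⟨ periodic i<k ⟨
    f (b + i)       ∎
    where open ≡-Reasoning
  split : applyUpTo f n ≡ applyUpTo f b ++ (X ++ X) ++ T
  split = begin
    applyUpTo f n                                  ≡⟨ cong (applyUpTo f) (proj₂ (m≤n⇒∃[o]m+o≡n bound)) ⟨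
    applyUpTo f (b + k + k + r)                    ≡⟨ applyUpTo-+ f (b + k + k) r ⟩
    applyUpTo f (b + k + k) ++ T                   ≡⟨ cong (_++ T) (applyUpTo-+ f (b + k) k) ⟩
    (applyUpTo f (b + k) ++ _) ++ T                ≡⟨ cong (λ z → (applyUpTo f (b + k) ++ z) ++ T) shifted ⟩
    (applyUpTo f (b + k) ++ X) ++ T                ≡⟨ cong (λ z → (z ++ X) ++ T) (applyUpTo-+ f b k) ⟩
    ((applyUpTo f b ++ X) ++ X) ++ T               ≡⟨ cong (_++ T) (++-assoc (applyUpTo f b) X X) ⟩
    (applyUpTo f b ++ (X ++ X)) ++ T               ≡⟨ ++-assoc (applyUpTo f b) (X ++ X) T ⟩
    applyUpTo f b ++ (X ++ X) ++ T                 ∎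
    where open ≡-Reasoning

Succ : Rel ℕ 0ℓ
Succ m n = n ≡ suc m

Staircase : List ℕ → Set
Staircase = Linked (ReflClosure Succ)

step⇒≤ : ∀ {m n} → ReflClosure Succ m n → m ≤ n
step⇒≤ refl     = ≤-refl
step⇒≤ [ refl ] = n≤1+n _

staircase-head-≤ : ∀ {p P} → Staircase (p ∷ P) → All (p ≤_) (p ∷ P)
staircase-head-≤ l = Linked⇒All ≤-trans ≤-refl (Linked.map step⇒≤ l)

staircase-≤-next : ∀ P {q Q} → Staircase (P ++ q ∷ Q) → All (_≤ q) P
staircase-≤-next []          _       = []
staircase-≤-next (x ∷ [])    (s ∷ _) = step⇒≤ s ∷ []
staircase-≤-next (x ∷ y ∷ P) (s ∷ l) with staircase-≤-next (y ∷ P) l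
... | y≤q ∷ h = ≤-trans (step⇒≤ s) y≤q ∷ y≤q ∷ h

staircase-covers : ∀ {p v q} P {Q} → Staircase (p ∷ P ++ q ∷ Q) → p ≤ v → v < q → v ∈ p ∷ P
staircase-covers []      (refl ∷ _)     p≤v v<p   = ⊥-elim (<⇒≱ v<p p≤v)
staircase-covers []      ([ refl ] ∷ _) p≤v v<1+p = here (≤-antisym (s≤s⁻¹ v<1+p) p≤v)
staircase-covers {p} {v} (x ∷ P) (s ∷ l) p≤v v<q with v ≟ p | s
... | yes v≡p | _        = here v≡p
... | no _    | refl     = there (staircase-covers P l p≤v v<q)
... | no v≢p  | [ refl ] = there (staircase-covers P l (≤∧≢⇒< p≤v (v≢p ∘ sym)) v<q)

repeated-staircase-constant : ∀ {p P} → Staircase (p ∷ P ++ p ∷ P) → All (_≡ p) (p ∷ P ++ p ∷ P)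
repeated-staircase-constant {p} {P} l = All.++⁺ constant constant
  where
  constant : All (_≡ p) (p ∷ P)
  constant = All.zipWith (λ (v≤p , p≤v) → ≤-antisym v≤p p≤v)
    (staircase-≤-next (p ∷ P) l , staircase-head-≤ (Linked-++⁻ˡ (p ∷ P) l))

module _ (w : ℕ → A) {n : ℕ} (distinct : ∀ {q} → suc q < n → w q ≢ w (suc q)) where

  -- A 0-step against a 1-step would make two adjacent letters of w equal.
  step-sync : ∀ {D p p′ q q′} → ReflClosure Succ p p′ → ReflClosure Succ q q′ → p′ < n → q′ < n →
              w p ≡ w q → w p′ ≡ w q′ → q ≡ p + D → q′ ≡ p′ + D
  step-sync refl     refl     _    _    _     _      e = e
  step-sync [ refl ] [ refl ] _    _    _     _      e = cong suc e
  step-sync refl     [ refl ] _    q′<n wp≡wq wp≡wq′ _ = ⊥-elim (distinct q′<n (trans (sym wp≡wq) wp≡wq′))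
  step-sync [ refl ] refl     p′<n _    wp≡wq wp′≡wq _ = ⊥-elim (distinct p′<n (trans wp≡wq (sym wp′≡wq)))

  staircase-sync : ∀ {D p q P Q} → Staircase (p ∷ P) → Staircase (q ∷ Q) →
                   All (_< n) (p ∷ P) → All (_< n) (q ∷ Q) →
                   map w (p ∷ P) ≡ map w (q ∷ Q) → q ≡ p + D → q ∷ Q ≡ map (_+ D) (p ∷ P)
  staircase-sync [-]     [-]     _        _        _  e = cong (_∷ []) e
  staircase-sync [-]     (_ ∷ _) _        _        eq _ with () ← ∷-injectiveʳ eq
  staircase-sync (_ ∷ _) [-]     _        _        eq _ with () ← ∷-injectiveʳ eq
  staircase-sync {p = p} {q} {p′ ∷ P} {q′ ∷ Q} (s ∷ l) (t ∷ m) (_ ∷ bp) (_ ∷ bq) eq e =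
    cong₂ _∷_ e (staircase-sync l m bp bq tail-eq
      (step-sync s t (All.head bp) (All.head bq) (proj₁ (∷-injective eq)) (proj₁ (∷-injective tail-eq)) e))
    where
    tail-eq : map w (p′ ∷ P) ≡ map w (q′ ∷ Q)
    tail-eq = proj₂ (∷-injective eq)

module _ (w : ℕ → A) {n : ℕ} (sf : SquareFree (applyUpTo w n)) where

  SquareFree⇒adjacent-≢ : ∀ {q} → suc q < n → w q ≢ w (suc q)
  SquareFree⇒adjacent-≢ {q} 1+q<n wq≡w1+q = periodic⇒¬SquareFree w (s≤s z≤n) bound periodic sf
    where
    q+1≡1+q : q + 1 ≡ suc q
    q+1≡1+q = +-comm q 1
    bound : q + 1 + 1 ≤ n
    bound = subst (_≤ n) (sym (trans (+-comm (q + 1) 1) (cong suc q+1≡1+q))) 1+q<n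
    periodic : ∀ {i} → i < 1 → w (q + i) ≡ w (q + i + 1)
    periodic (s≤s z≤n) = subst₂ (λ i j → w i ≡ w j)
      (sym (+-identityʳ q)) (sym (trans (cong (_+ 1) (+-identityʳ q)) q+1≡1+q)) wq≡w1+q

  no-positive-shift : ∀ {D p q P Q} → Staircase (p ∷ P ++ q ∷ Q) → All (_< n) (q ∷ Q) →
                      map w (p ∷ P) ≡ map w (q ∷ Q) →
                      q ≡ p + suc D → q ∷ Q ≡ map (_+ suc D) (p ∷ P) → ⊥
  no-positive-shift {D} {p} {P = P} l bq eq e sync = periodic⇒¬SquareFree w (s≤s z≤n) bound periodic sf
    where
    covered : ∀ {i} → i < suc D → p + i ∈ p ∷ P
    covered i<k = staircase-covers P l (m≤m+n p _) (subst (p + _ <_) (sym e) (+-monoʳ-< p i<k))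
    periodic : ∀ {i} → i < suc D → w (p + i) ≡ w (p + i + suc D)
    periodic i<k = map-≡⇒∈-≡ (trans eq (trans (cong (map w) sync) (sym (map-∘ (p ∷ P))))) (covered i<k)
    bound : p + suc D + suc D ≤ n
    bound = subst (_≤ n) (cong (_+ suc D) (sym (+-suc p D)))
      (All.lookup bq (subst (p + D + suc D ∈_) (sym sync) (∈-map⁺ (_+ suc D) (covered ≤-refl))))

  staircase-square-constant : ∀ {p q P Q} → Staircase (p ∷ P ++ q ∷ Q) → All (_< n) (p ∷ P ++ q ∷ Q) →
                              map w (p ∷ P) ≡ map w (q ∷ Q) → All (_≡ p) (p ∷ P ++ q ∷ Q)
  staircase-square-constant {p} {q} {P} {Q} l b eq = by-shift (q ∸ p) (sym (m+[n∸m]≡n p≤q))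
    where
    p≤q : p ≤ q
    p≤q = All.head (All.++⁻ʳ (p ∷ P) (staircase-head-≤ l))
    sync : ∀ {D} → q ≡ p + D → q ∷ Q ≡ map (_+ D) (p ∷ P)
    sync = staircase-sync w SquareFree⇒adjacent-≢ (Linked-++⁻ˡ (p ∷ P) l) (Linked-++⁻ʳ (p ∷ P) l)
      (All.++⁻ˡ (p ∷ P) b) (All.++⁻ʳ (p ∷ P) b) eq
    by-shift : ∀ D → q ≡ p + D → All (_≡ p) (p ∷ P ++ q ∷ Q)
    by-shift zero    e = subst (λ ys → All (_≡ p) (p ∷ P ++ ys)) (sym unshifted)
      (repeated-staircase-constant (subst (λ ys → Staircase (p ∷ P ++ ys)) unshifted l))
      where
      unshifted : q ∷ Q ≡ p ∷ P
      unshifted = trans (sync e) (trans (map-cong +-identityʳ (p ∷ P)) (map-id (p ∷ P)))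
    by-shift (suc D) e = ⊥-elim (no-positive-shift l (All.++⁻ʳ (p ∷ P) b) eq e (sync e))

  square-over-staircase-constant : ∀ P Q {Y} → Y ≢ [] → Staircase (P ++ Q) → All (_< n) (P ++ Q) →
                           map w P ≡ Y → map w Q ≡ Y → ∃[ p ] p < n × All (_≡ w p) (Y ++ Y)
  square-over-staircase-constant []      _       Y≢[] _ _ refl _  = ⊥-elim (Y≢[] refl)
  square-over-staircase-constant (_ ∷ _) []      _    _ _ refl ()
  square-over-staircase-constant (p ∷ P) (q ∷ Q) _    l b refl eq =
    p , All.head b , subst (All (_≡ w p)) image (All.map⁺ (All.map (cong w) (staircase-square-constant l b (sym eq))))
    where
    image : map w (p ∷ P ++ q ∷ Q) ≡ map w (p ∷ P) ++ map w (p ∷ P)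
    image = trans (map-++ w (p ∷ P) (q ∷ Q)) (cong (map w (p ∷ P) ++_) eq)

  square-factor-constant : ∀ {I s} → Staircase I → All (_< n) I → IsFactor s (map w I) → IsSquare s →
                           ∃[ p ] p < n × All (_≡ w p) s
  square-factor-constant st b fac (Y , Y≢[] , refl)
    with J , J-fac , mapJ ← IsFactor-map⁻ w fac
    with P , Q , refl , mapP , mapQ ← map-++⁻ w J {Y} mapJ
    = square-over-staircase-constant P Q Y≢[] (Linked-factor J-fac st) (All-factor J-fac b) mapP mapQ

lemma2p8 : {A : Set} (W : List A) (ks : List ℕ) →
    SquareFree W → length ks ≡ length W → All (1 ≤_) ks →
    ∀ (s : List A) → IsFactor s (expand ks W) → IsSquare s →
    ∃[ x ] ∃[ k ] (x ∈ W × 1 ≤ k × s ≡ replicate (2 * k) x)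
lemma2p8 W ks sf _ pos s fac ([] , Y≢[] , _) = ⊥-elim (Y≢[] refl)
lemma2p8 {A} W ks sf _ pos s fac sq@(d ∷ Y , _ , refl) =
  letter-of (square-factor-constant w (subst SquareFree W≡applyUpTo sf) staircase bounded fac′ sq)
  where
  w : ℕ → A
  w = lookupOr d W
  n : ℕ
  n = length W
  I : List ℕ
  I = expand ks (upTo n)
  W≡applyUpTo : W ≡ applyUpTo w n
  W≡applyUpTo = applyUpTo-lookupOr d W
  W≡map : W ≡ map w (upTo n)
  W≡map = trans W≡applyUpTo (sym (map-upTo w n))
  staircase : Staircase I
  staircase = Linked-expand⁺ pos (applyUpTo⁺₂ id n (λ _ → refl))
  bounded : All (_< n) I
  bounded = All-expand⁺ ks (all-upTo n)
  fac′ : IsFactor s (map w I)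
  fac′ = subst (IsFactor s) (trans (cong (expand ks) W≡map) (expand-map ks w (upTo n))) fac
  length-square : length (d ∷ Y ++ d ∷ Y) ≡ 2 * length (d ∷ Y)
  length-square = trans (length-++ (d ∷ Y)) (cong (length (d ∷ Y) +_) (sym (+-identityʳ _)))
  letter-of : ∃[ p ] p < n × All (_≡ w p) s → ∃[ x ] ∃[ k ] (x ∈ W × 1 ≤ k × s ≡ replicate (2 * k) x)
  letter-of (p , p<n , constant) =
    w p , length (d ∷ Y) , subst (w p ∈_) (sym W≡map) (∈-map⁺ w (∈-upTo⁺ p<n)) , s≤s z≤n ,
    trans (All-≡⇒replicate constant) (cong (λ m → replicate m (w p)) length-square)
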